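{- For every integer $r\ge3$, \[ \mathscr{P}_{B_r}^{NH} (q) = (1+q)^2 \mathscr{P}_{B_{r-1}}^{NH} (q) - q^3 \left( \sum_{i=1}^{r-2} \mathscr{P}_{B_i}^{NH}(q) \right ). \]
   Context: Type $B_n$ ($n\ge1$): with simple roots $\alpha_1,\dots,\alpha_n$, the positive roots are the nonhooked roots $\alpha_i+\cdots+\alpha_j$ ($1\le i\le j\le n$) and the hooked roots $\alpha_i+\cdots+\alpha_{j-1}+2\alpha_j+\cdots+2\alpha_n$ ($1\le i<j\le n$); the highest root is $\tilde\alpha=\alpha_1+2\alpha_2+\cdots+2\alpha_n$ (equal to $\alpha_1$ if $n=1$). A partition of $\tilde\alpha$ with $k$ parts is a multiset of $k$ positive roots (repetitions allowed) summing to $\tilde\alpha$. $\mathscr{P}^{NH}_{B_n}(q)=\sum_kd_kq^k$ where $d_k$ is the number of partitions of $\tilde\alpha$ with exactly $k$ parts none of which is a hooked root. -}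

module Defs where

open import Data.Nat using (ℕ; zero; suc; _+_; _*_; _∸_; _≤ᵇ_; _≡ᵇ_)
open import Data.Nat.Properties using (_≟_)
open import Data.Integer using (ℤ; +_) renaming (_+_ to _+ℤ_; _-_ to _-ℤ_)
open import Data.Bool using (Bool; true; false; if_then_else_; _∧_)
open import Data.List using (List; []; _∷_; _++_; map; concatMap; upTo)
open import Data.Nat.ListAction using (sum)
open import Data.Vec using (Vec; tabulate; replicate; zipWith)
open import Data.Vec.Properties using (≡-dec)
open import Data.Fin using (Fin; toℕ)
open import Data.Product using (_×_; _,_)
open import Relation.Nullary.Decidable using (⌊_⌋)

-- Type B_n, simple roots α_1..α_n.  A root is its coefficient vector in Vec ℕ n;
-- position p (Fin n, i.e. index toℕ p + 1) holds the coefficient of α_{toℕ p + 1}.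

intervals : ℕ → List (ℕ × ℕ)
intervals n = concatMap (λ i → map (λ j → (suc i , suc i + j)) (upTo (n ∸ i))) (upTo n)

-- The nonhooked root α_i + ... + α_j.
nonhooked : (n : ℕ) → ℕ × ℕ → Vec ℕ n
nonhooked n (i , j) = tabulate (λ p → if (i ≤ᵇ suc (toℕ p)) ∧ (suc (toℕ p) ≤ᵇ j) then 1 else 0)

nonhookedRoots : (n : ℕ) → List (Vec ℕ n)
nonhookedRoots n = map (nonhooked n) (intervals n)

highest : (n : ℕ) → Vec ℕ n
highest n = tabulate (λ p → if toℕ p ≡ᵇ 0 then 1 else 2)

_⊞_ : ∀ {n} → Vec ℕ n → Vec ℕ n → Vec ℕ n
_⊞_ = zipWith _+_

scale : ∀ {n} → ℕ → Vec ℕ n → Vec ℕ n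
scale m = Data.Vec.map (m *_)

-- Multisets over the distinct roots rs are exactly
-- multiplicity assignments; a multiplicity never exceeds the number of parts.
countMS : ∀ {n} → List (Vec ℕ n) → Vec ℕ n → Vec ℕ n → ℕ → ℕ
countMS [] target acc k = if ⌊ ≡-dec _≟_ acc target ⌋ ∧ (k ≡ᵇ 0) then 1 else 0
countMS (ρ ∷ rs) target acc k =
  sum (map (λ m → countMS rs target (acc ⊞ scale m ρ) (k ∸ m)) (upTo (suc k)))

dNH : ℕ → ℕ → ℕ
dNH n k = countMS (nonhookedRoots n) (highest n) (replicate n 0) k

-- Polynomials with integer coefficients, as coefficient sequences (coefficient of q^k).
Poly : Set
Poly = ℕ → ℤ

_⊕_ : Poly → Poly → Poly
(f ⊕ g) k = f k +ℤ g k

_⊖_ : Poly → Poly → Poly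
(f ⊖ g) k = f k -ℤ g k

qmul : Poly → Poly
qmul f zero = + 0
qmul f (suc k) = f k

onePlusQ : Poly → Poly
onePlusQ f = f ⊕ qmul f

zeroP : Poly
zeroP _ = + 0

sumP : (ℕ → Poly) → ℕ → Poly
sumP F zero = zeroP
sumP F (suc m) = sumP F m ⊕ F (suc m)

PNH : ℕ → Poly
PNH n k = + dNH n k

module Submission where

-- A nonhooked root of B_{n+1} is either 1 ∷ s with s = α_1 + … + α_j an initial
-- segment of B_n (0 ≤ j ≤ n), or 0 ∷ ρ with ρ a nonhooked root of B_n.  Hence,
-- when a multiset of roots must raise the first coordinate by d, exactly d
-- roots (with repetition) are chosen among the 1 ∷ s, contributing q^d; the
-- remaining roots solve the same problem in B_n.  For the target
-- α_1 + … + α_a + 2α_{a+1} + … + 2α_n with generating polynomial W_n(a)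
-- (so P_{B_{n+1}} = W_{n+1}(1)) this peeling gives, with E_n = Σ_{a≤n} W_n(a)
-- and S_n = E_0 + … + E_n,
--   W_{n+1}(1) = q E_n,   W_{n+2}(a+2) = (1+q) W_{n+1}(a+1),   W_{n+1}(0) = q² S_n,
-- and the theorem is a linear identity between these polynomials.

open import Defs
open import Data.Nat using (ℕ; zero; suc; _+_; _*_; _∸_; _≤_; _<_; s≤s; _<ᵇ_; _≡ᵇ_)
open import Data.Nat.Properties
open import Data.Bool using (if_then_else_; _∧_)
open import Data.List using (List; []; _∷_; _++_; map; upTo; applyUpTo; concatMap)
open import Data.List.Properties using (map-cong; map-∘; map-++; map-concatMap; concatMap-map; concatMap-cong; map-applyUpTo; map-upTo)
open import Data.Nat.ListAction using (sum)
open import Data.Vec using (Vec; []; _∷_; tabulate; replicate)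
open import Data.Vec.Properties using (≡-dec; tabulate-cong; ∷-injectiveˡ; ∷-injectiveʳ; zipWith-assoc; zipWith-identityˡ; zipWith-identityʳ; map-const)
open import Data.Fin using (toℕ)
open import Data.Product using (_×_; _,_)
open import Data.Empty using (⊥-elim)
open import Relation.Nullary using (yes; no; ¬_; Dec)
open import Relation.Nullary.Decidable using (⌊_⌋)
open import Relation.Binary.PropositionalEquality
open import Algebra.Properties.CommutativeSemigroup +-commutativeSemigroup using (interchange)
open import Data.Nat.Solver using (module +-*-Solver)
open import Data.Integer using () renaming (+_ to pos; _+_ to _+ℤ_; _-_ to _-ℤ_)
open import Data.Integer.Properties using (pos-+; [+m]-[+n]≡m⊖n; ⊖-≥)

sum-cong : ∀ {A : Set} {f g : A → ℕ} → f ≗ g → ∀ xs → sum (map f xs) ≡ sum (map g xs)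
sum-cong f≗g xs = cong sum (map-cong f≗g xs)

sum-zero : ∀ {A : Set} (f : A → ℕ) → f ≗ (λ _ → 0) → ∀ xs → sum (map f xs) ≡ 0
sum-zero f f≗0 [] = refl
sum-zero f f≗0 (x ∷ xs) rewrite f≗0 x = sum-zero f f≗0 xs

sum-+ : ∀ {A : Set} (f g : A → ℕ) xs → sum (map (λ x → f x + g x) xs) ≡ sum (map f xs) + sum (map g xs)
sum-+ f g [] = refl
sum-+ f g (x ∷ xs) = trans (cong (f x + g x +_) (sum-+ f g xs)) (interchange (f x) (g x) _ _)

sum-upTo-suc : ∀ (g : ℕ → ℕ) k → sum (map g (upTo (suc k))) ≡ g 0 + sum (map (λ m → g (suc m)) (upTo k))
sum-upTo-suc g k = cong (λ xs → g 0 + sum xs) (trans (map-applyUpTo suc g k) (sym (map-upTo (λ m → g (suc m)) k)))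

ℕPoly : Set
ℕPoly = ℕ → ℕ

0ₚ : ℕPoly
0ₚ _ = 0

_+ₚ_ : ℕPoly → ℕPoly → ℕPoly
(f +ₚ g) k = f k + g k

infixl 6 _+ₚ_
infixr 7 q·_ q^_·_ [1+q]·_

q·_ : ℕPoly → ℕPoly
(q· f) zero = 0
(q· f) (suc k) = f k

q^_·_ : ℕ → ℕPoly → ℕPoly
q^ zero · f = f
q^ suc d · f = q· q^ d · f

[1+q]·_ : ℕPoly → ℕPoly
[1+q]· f = f +ₚ q· f

Σₚ : ∀ {A : Set} → List A → (A → ℕPoly) → ℕPoly
Σₚ xs F k = sum (map (λ j → F j k) xs)

q·-cong : ∀ {f g} → f ≗ g → q· f ≗ q· g
q·-cong f≗g zero = refl
q·-cong f≗g (suc k) = f≗g k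

q·-+ : ∀ f g → q· (f +ₚ g) ≗ q· f +ₚ q· g
q·-+ f g zero = refl
q·-+ f g (suc k) = refl

q^-+ : ∀ d f g → q^ d · (f +ₚ g) ≗ q^ d · f +ₚ q^ d · g
q^-+ zero f g k = refl
q^-+ (suc d) f g zero = refl
q^-+ (suc d) f g (suc k) = q^-+ d f g k

q^-0 : ∀ d → q^ d · 0ₚ ≗ 0ₚ
q^-0 zero k = refl
q^-0 (suc d) zero = refl
q^-0 (suc d) (suc k) = q^-0 d k

q^-cong : ∀ d {f g} → f ≗ g → q^ d · f ≗ q^ d · g
q^-cong zero f≗g = f≗g
q^-cong (suc d) f≗g = q·-cong (q^-cong d f≗g)

[1+q]·-cong : ∀ {f g} → f ≗ g → [1+q]· f ≗ [1+q]· g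
[1+q]·-cong f≗g k = cong₂ _+_ (f≗g k) (q·-cong f≗g k)

q·-Σ : ∀ {A : Set} (xs : List A) F → q· Σₚ xs F ≗ Σₚ xs (λ j → q· F j)
q·-Σ xs F zero = sym (sum-zero _ (λ _ → refl) xs)
q·-Σ xs F (suc k) = refl

[1+q]·-Σ : ∀ {A : Set} (xs : List A) F → [1+q]· Σₚ xs F ≗ Σₚ xs (λ j → [1+q]· F j)
[1+q]·-Σ xs F k = trans (cong (Σₚ xs F k +_) (q·-Σ xs F k)) (sym (sum-+ (λ j → F j k) (λ j → (q· F j) k) xs))

Σₚ-cong : ∀ {A : Set} (xs : List A) {F G : A → ℕPoly} → (∀ j → F j ≗ G j) → Σₚ xs F ≗ Σₚ xs G
Σₚ-cong xs F≗G k = sum-cong (λ j → F≗G j k) xs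

zeros : ∀ n → Vec ℕ n
zeros n = replicate n 0

⊞-assoc : ∀ {n} (x y z : Vec ℕ n) → (x ⊞ y) ⊞ z ≡ x ⊞ (y ⊞ z)
⊞-assoc = zipWith-assoc +-assoc

⊞-identityˡ : ∀ {n} (x : Vec ℕ n) → zeros n ⊞ x ≡ x
⊞-identityˡ = zipWith-identityˡ +-identityˡ

⊞-identityʳ : ∀ {n} (x : Vec ℕ n) → x ⊞ zeros n ≡ x
⊞-identityʳ = zipWith-identityʳ +-identityʳ

⊞-cancelˡ : ∀ {n} (x y z : Vec ℕ n) → x ⊞ y ≡ x ⊞ z → y ≡ z
⊞-cancelˡ [] [] [] _ = refl
⊞-cancelˡ (a ∷ x) (b ∷ y) (c ∷ z) e =
  cong₂ _∷_ (+-cancelˡ-≡ a b c (∷-injectiveˡ e)) (⊞-cancelˡ x y z (∷-injectiveʳ e))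

scale-zero : ∀ {n} (x v : Vec ℕ n) → x ⊞ scale 0 v ≡ x
scale-zero x v = trans (cong (x ⊞_) (map-const v 0)) (⊞-identityʳ x)

scale-suc : ∀ {n} m (v : Vec ℕ n) → scale (suc m) v ≡ v ⊞ scale m v
scale-suc m [] = refl
scale-suc m (b ∷ v) = cong (b + m * b ∷_) (scale-suc m v)

-- A continuation receives the
-- sum accumulated so far and the number of parts still to be chosen;
-- count rs F acc k sums F (acc + ΣM) (k − |M|) over the multisets M of elements
-- of rs with |M| ≤ k, given as multiplicities in the order of rs.

Cont : ℕ → Set
Cont n = Vec ℕ n → ℕ → ℕ

count : ∀ {n} → List (Vec ℕ n) → Cont n → Cont n
count [] F acc k = F acc k
count (ρ ∷ rs) F acc k = sum (map (λ m → count rs F (acc ⊞ scale m ρ) (k ∸ m)) (upTo (suc k)))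

exactly : ∀ {n} → Vec ℕ n → Cont n
exactly t acc k = if ⌊ ≡-dec _≟_ acc t ⌋ ∧ (k ≡ᵇ 0) then 1 else 0

countMS-as-count : ∀ {n} (rs : List (Vec ℕ n)) t acc k → countMS rs t acc k ≡ count rs (exactly t) acc k
countMS-as-count [] t acc k = refl
countMS-as-count (ρ ∷ rs) t acc k = sum-cong (λ m → countMS-as-count rs t _ (k ∸ m)) (upTo (suc k))

count-cong : ∀ {n} (rs : List (Vec ℕ n)) {F G : Cont n} → (∀ a k → F a k ≡ G a k) → ∀ acc k → count rs F acc k ≡ count rs G acc k
count-cong [] F≡G acc k = F≡G acc k
count-cong (ρ ∷ rs) F≡G acc k = sum-cong (λ m → count-cong rs F≡G _ (k ∸ m)) (upTo (suc k))

count-++ : ∀ {n} (xs ys : List (Vec ℕ n)) F acc k → count (xs ++ ys) F acc k ≡ count xs (count ys F) acc k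
count-++ [] ys F acc k = refl
count-++ (ρ ∷ xs) ys F acc k = sum-cong (λ m → count-++ xs ys F _ (k ∸ m)) (upTo (suc k))

count-0 : ∀ {n} (rs : List (Vec ℕ n)) acc k → count rs (λ _ _ → 0) acc k ≡ 0
count-0 [] acc k = refl
count-0 (ρ ∷ rs) acc k = sum-zero _ (λ m → count-0 rs _ (k ∸ m)) (upTo (suc k))

count-guard : ∀ {n} {P : Set} (d : Dec P) (rs : List (Vec ℕ n)) (F : Cont n) acc k →
  count rs (λ a k′ → if ⌊ d ⌋ then F a k′ else 0) acc k ≡ (if ⌊ d ⌋ then count rs F acc k else 0)
count-guard (yes _) rs F acc k = refl
count-guard (no _) rs F acc k = count-0 rs acc k

count-map-0∷ : ∀ {n} (rs : List (Vec ℕ n)) (F : Cont (suc n)) c acc k →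
  count (map (0 ∷_) rs) F (c ∷ acc) k ≡ count rs (λ a → F (c ∷ a)) acc k
count-map-0∷ [] F c acc k = refl
count-map-0∷ (ρ ∷ rs) F c acc k = sum-cong term (upTo (suc k))
  where
    term : ∀ m → count (map (0 ∷_) rs) F ((c + m * 0) ∷ (acc ⊞ scale m ρ)) (k ∸ m)
               ≡ count rs (λ a → F (c ∷ a)) (acc ⊞ scale m ρ) (k ∸ m)
    term m rewrite *-zeroʳ m | +-identityʳ c = count-map-0∷ rs F c _ (k ∸ m)

count-translate : ∀ {n} (rs : List (Vec ℕ n)) F x y k → count rs F (x ⊞ y) k ≡ count rs (λ a → F (x ⊞ a)) y k
count-translate [] F x y k = refl
count-translate (ρ ∷ rs) F x y k = sum-cong term (upTo (suc k))
  where
    term : ∀ m → count rs F ((x ⊞ y) ⊞ scale m ρ) (k ∸ m) ≡ count rs (λ a → F (x ⊞ a)) (y ⊞ scale m ρ) (k ∸ m)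
    term m rewrite ⊞-assoc x y (scale m ρ) = count-translate rs F x _ (k ∸ m)

exactly-translate : ∀ {n} (x t a : Vec ℕ n) k → exactly (x ⊞ t) (x ⊞ a) k ≡ exactly t a k
exactly-translate x t a k with ≡-dec _≟_ (x ⊞ a) (x ⊞ t) | ≡-dec _≟_ a t
... | yes _ | yes _ = refl
... | yes p | no ¬q = ⊥-elim (¬q (⊞-cancelˡ x a t p))
... | no ¬p | yes q = ⊥-elim (¬p (cong (x ⊞_) q))
... | no _ | no _ = refl

count-exactly-translate : ∀ {n} (rs : List (Vec ℕ n)) x t y k →
  count rs (exactly (x ⊞ t)) (x ⊞ y) k ≡ count rs (exactly t) y k
count-exactly-translate rs x t y k =
  trans (count-translate rs (exactly (x ⊞ t)) x y k) (count-cong rs (λ a k′ → exactly-translate x t a k′) y k)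

firstIs : ∀ {n} → ℕ → Cont n → Cont (suc n)
firstIs t₀ F (c ∷ a) k = if ⌊ c ≟ t₀ ⌋ then F a k else 0

exactly-∷ : ∀ {n} t₀ (t : Vec ℕ n) → ∀ a k → exactly (t₀ ∷ t) a k ≡ firstIs t₀ (exactly t) a k
exactly-∷ t₀ t (c ∷ a) k with ≡-dec _≟_ (c ∷ a) (t₀ ∷ t) | c ≟ t₀ | ≡-dec _≟_ a t
... | yes _ | yes _ | yes _ = refl
... | yes p | no ¬q | _ = ⊥-elim (¬q (∷-injectiveˡ p))
... | yes p | yes _ | no ¬r = ⊥-elim (¬r (∷-injectiveʳ p))
... | no ¬p | yes refl | yes refl = ⊥-elim (¬p refl)
... | no _ | yes _ | no _ = refl
... | no _ | no _ | _ = refl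

count-map-0∷-firstIs : ∀ {n} (rs : List (Vec ℕ n)) t₀ t → ∀ a k →
  count (map (0 ∷_) rs) (exactly (t₀ ∷ t)) a k ≡ firstIs t₀ (count rs (exactly t)) a k
count-map-0∷-firstIs rs t₀ t (c ∷ a) k = begin
    count (map (0 ∷_) rs) (exactly (t₀ ∷ t)) (c ∷ a) k
  ≡⟨ count-map-0∷ rs (exactly (t₀ ∷ t)) c a k ⟩
    count rs (λ a′ → exactly (t₀ ∷ t) (c ∷ a′)) a k
  ≡⟨ count-cong rs (λ a′ k′ → exactly-∷ t₀ t (c ∷ a′) k′) a k ⟩
    count rs (λ a′ k′ → if ⌊ c ≟ t₀ ⌋ then exactly t a′ k′ else 0) a k
  ≡⟨ count-guard (c ≟ t₀) rs (exactly t) a k ⟩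
    firstIs t₀ (count rs (exactly t)) (c ∷ a) k ∎
  where open ≡-Reasoning

-- segment n j has its first j coordinates equal to 1 and the others 0; for
-- 0 ≤ j ≤ n, 1 ∷ segment n j is the root α_1 + … + α_{j+1} of B_{n+1}.
segment : ∀ n → ℕ → Vec ℕ n
segment n j = tabulate (λ p → if toℕ p <ᵇ j then 1 else 0)

segments : ∀ n → List (Vec ℕ n)
segments n = map (segment n) (upTo (suc n))

segment-0 : ∀ n → segment n 0 ≡ zeros n
segment-0 zero = refl
segment-0 (suc n) = cong (0 ∷_) (segment-0 n)

segments-split : ∀ n → segments n ≡ zeros n ∷ map (λ j → segment n (suc j)) (upTo n)
segments-split n = cong₂ _∷_ (segment-0 n) (trans (map-applyUpTo suc (segment n) n) (sym (map-upTo _ n)))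

segments-tail : ∀ n → map (λ j → segment (suc n) (suc j)) (upTo (suc n)) ≡ map (1 ∷_) (segments n)
segments-tail n = map-∘ (upTo (suc n))

nonhookedRoots-suc : ∀ n → nonhookedRoots (suc n) ≡ map (1 ∷_) (segments n) ++ map (0 ∷_) (nonhookedRoots n)
nonhookedRoots-suc n = begin
    map (nonhooked (suc n)) (block (suc n) 0 ++ concatMap (block (suc n)) (applyUpTo suc n))
  ≡⟨ map-++ (nonhooked (suc n)) (block (suc n) 0) _ ⟩
    map (nonhooked (suc n)) (block (suc n) 0) ++ map (nonhooked (suc n)) (concatMap (block (suc n)) (applyUpTo suc n))
  ≡⟨ cong₂ _++_ starting shifted ⟩
    map (1 ∷_) (segments n) ++ map (0 ∷_) (nonhookedRoots n) ∎
  where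
    open ≡-Reasoning
    block : ℕ → ℕ → List (ℕ × ℕ)
    block m i = map (λ j → (suc i , suc i + j)) (upTo (m ∸ i))
    starting : map (nonhooked (suc n)) (block (suc n) 0) ≡ map (1 ∷_) (segments n)
    starting = trans (sym (map-∘ (upTo (suc n)))) (map-∘ (upTo (suc n)))
    shifted : map (nonhooked (suc n)) (concatMap (block (suc n)) (applyUpTo suc n)) ≡ map (0 ∷_) (nonhookedRoots n)
    shifted = begin
        map (nonhooked (suc n)) (concatMap (block (suc n)) (applyUpTo suc n))
      ≡⟨ map-concatMap (nonhooked (suc n)) (block (suc n)) (applyUpTo suc n) ⟩
        concatMap (λ i → map (nonhooked (suc n)) (block (suc n) i)) (applyUpTo suc n)
      ≡⟨ cong (concatMap (λ i → map (nonhooked (suc n)) (block (suc n) i))) (sym (map-upTo suc n)) ⟩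
        concatMap (λ i → map (nonhooked (suc n)) (block (suc n) i)) (map suc (upTo n))
      ≡⟨ concatMap-map (λ i → map (nonhooked (suc n)) (block (suc n) i)) suc (upTo n) ⟩
        concatMap (λ i → map (nonhooked (suc n)) (block (suc n) (suc i))) (upTo n)
      ≡⟨ concatMap-cong (λ i → trans (sym (map-∘ (upTo (n ∸ i)))) (trans (map-∘ (upTo (n ∸ i))) (map-∘ (block n i)))) (upTo n) ⟩
        concatMap (λ i → map (0 ∷_) (map (nonhooked n) (block n i))) (upTo n)
      ≡⟨ sym (map-concatMap (0 ∷_) (λ i → map (nonhooked n) (block n i)) (upTo n)) ⟩
        map (0 ∷_) (concatMap (λ i → map (nonhooked n) (block n i)) (upTo n))
      ≡⟨ cong (map (0 ∷_)) (sym (map-concatMap (nonhooked n) (block n) (upTo n))) ⟩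
        map (0 ∷_) (nonhookedRoots n) ∎

ways : ∀ n → Vec ℕ n → Cont n
ways n t = count (nonhookedRoots n) (exactly t)

peel : ∀ {n} → Cont n → ℕ → List (Vec ℕ n) → ℕ → Vec ℕ n → ℕPoly
peel F t₀ L c x = count (map (1 ∷_) L) (firstIs t₀ F) (c ∷ x)

ways-suc : ∀ n t₀ t c w → ways (suc n) (t₀ ∷ t) (c ∷ w) ≗ peel (ways n t) t₀ (segments n) c w
ways-suc n t₀ t c w k =
  trans (cong (λ rs → count rs (exactly (t₀ ∷ t)) (c ∷ w) k) (nonhookedRoots-suc n))
  (trans (count-++ (map (1 ∷_) (segments n)) _ (exactly (t₀ ∷ t)) (c ∷ w) k)
         (count-cong (map (1 ∷_) (segments n)) (count-map-0∷-firstIs (nonhookedRoots n) t₀ t) (c ∷ w) k))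

choose : ∀ {n} → ℕ → List (Vec ℕ n) → Cont n → Cont n
choose zero L F x k = F x k
choose (suc d) [] F x k = 0
choose (suc d) (v ∷ L) F x k = choose d (v ∷ L) F (x ⊞ v) k + choose (suc d) L F x k

if-yes : ∀ {P : Set} (d : Dec P) {a : ℕ} → P → (if ⌊ d ⌋ then a else 0) ≡ a
if-yes (yes _) _ = refl
if-yes (no ¬p) p = ⊥-elim (¬p p)

if-no : ∀ {P : Set} (d : Dec P) {a : ℕ} → ¬ P → (if ⌊ d ⌋ then a else 0) ≡ 0
if-no (yes p) ¬p = ⊥-elim (¬p p)
if-no (no _) _ = refl

module Peeling {n : ℕ} (F : Cont n) where

  peel-overshoot : ∀ t₀ L c x k → t₀ < c → peel F t₀ L c x k ≡ 0
  peel-overshoot t₀ [] c x k t₀<c = if-no (c ≟ t₀) (λ c≡t₀ → <⇒≢ t₀<c (sym c≡t₀))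
  peel-overshoot t₀ (v ∷ L) c x k t₀<c =
    sum-zero _ (λ m → peel-overshoot t₀ L (c + m * 1) _ (k ∸ m) (<-≤-trans t₀<c (m≤m+n c _))) (upTo (suc k))

  peel-skip-head : ∀ t₀ L v c x k → peel F t₀ L (c + 0 * 1) (x ⊞ scale 0 v) k ≡ peel F t₀ L c x k
  peel-skip-head t₀ L v c x k = cong₂ (λ c′ x′ → peel F t₀ L c′ x′ k) (+-identityʳ c) (scale-zero x v)

  peel-no-parts : ∀ t₀ v L c x → peel F t₀ (v ∷ L) c x 0 ≡ peel F t₀ L c x 0
  peel-no-parts t₀ v L c x = trans (+-identityʳ _) (peel-skip-head t₀ L v c x 0)

  peel-step : ∀ t₀ v L c x k →
    peel F t₀ (v ∷ L) c x (suc k) ≡ peel F t₀ (v ∷ L) (suc c) (x ⊞ v) k + peel F t₀ L c x (suc k)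
  peel-step t₀ v L c x k = begin
      peel F t₀ (v ∷ L) c x (suc k)
    ≡⟨ sum-upTo-suc term (suc k) ⟩
      term 0 + sum (map (λ m → term (suc m)) (upTo (suc k)))
    ≡⟨ cong₂ _+_ (peel-skip-head t₀ L v c x (suc k)) (sum-cong shift (upTo (suc k))) ⟩
      peel F t₀ L c x (suc k) + peel F t₀ (v ∷ L) (suc c) (x ⊞ v) k
    ≡⟨ +-comm (peel F t₀ L c x (suc k)) _ ⟩
      peel F t₀ (v ∷ L) (suc c) (x ⊞ v) k + peel F t₀ L c x (suc k) ∎
    where
      open ≡-Reasoning
      term : ℕ → ℕ
      term m = peel F t₀ L (c + m * 1) (x ⊞ scale m v) (suc k ∸ m)
      shift : ∀ m → term (suc m) ≡ peel F t₀ L (suc c + m * 1) ((x ⊞ v) ⊞ scale m v) (k ∸ m)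
      shift m = cong₂ (λ c′ x′ → peel F t₀ L c′ x′ (k ∸ m))
                      (+-suc c (m * 1))
                      (trans (cong (x ⊞_) (scale-suc m v)) (sym (⊞-assoc x v (scale m v))))

  peel-exact : ∀ L d c x → peel F (d + c) L c x ≗ q^ d · choose d L F x
  peel-exact [] zero c x k = if-yes (c ≟ c) refl
  peel-exact [] (suc d) c x k = trans (if-no (c ≟ suc d + c) (m≢1+n+m c)) (sym (q^-0 (suc d) k))
  peel-exact (v ∷ L) zero c x zero = trans (peel-no-parts c v L c x) (peel-exact L zero c x zero)
  peel-exact (v ∷ L) (suc d) c x zero = trans (peel-no-parts (suc d + c) v L c x) (peel-exact L (suc d) c x zero)
  peel-exact (v ∷ L) zero c x (suc k) =
    trans (peel-step c v L c x k) (cong₂ _+_ (peel-overshoot c (v ∷ L) (suc c) (x ⊞ v) k ≤-refl) (peel-exact L zero c x (suc k)))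
  peel-exact (v ∷ L) (suc d) c x (suc k) = begin
      peel F (suc d + c) (v ∷ L) c x (suc k)
    ≡⟨ peel-step (suc d + c) v L c x k ⟩
      peel F (suc d + c) (v ∷ L) (suc c) (x ⊞ v) k + peel F (suc d + c) L c x (suc k)
    ≡⟨ cong₂ _+_ (trans (cong (λ t₀ → peel F t₀ (v ∷ L) (suc c) (x ⊞ v) k) (sym (+-suc d c)))
                        (peel-exact (v ∷ L) d (suc c) (x ⊞ v) k))
                 (peel-exact L (suc d) c x (suc k)) ⟩
      (q^ d · choose d (v ∷ L) F (x ⊞ v)) k + (q^ d · choose (suc d) L F x) k
    ≡⟨ sym (q^-+ d (choose d (v ∷ L) F (x ⊞ v)) (choose (suc d) L F x) k) ⟩
      (q^ suc d · choose (suc d) (v ∷ L) F x) (suc k) ∎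
    where open ≡-Reasoning

ways-first : ∀ n d c t w → ways (suc n) ((d + c) ∷ t) (c ∷ w) ≗ q^ d · choose d (segments n) (ways n t) w
ways-first n d c t w k = trans (ways-suc n (d + c) t c w k) (Peeling.peel-exact (ways n t) (segments n) d c w k)

ways-head : ∀ n c t w → ways (suc n) (c ∷ t) (c ∷ w) ≗ ways n t w
ways-head n c = ways-first n 0 c

ways-translate : ∀ n x t y → ways n (x ⊞ t) (x ⊞ y) ≗ ways n t y
ways-translate n = count-exactly-translate (nonhookedRoots n)

choose-cong : ∀ {n} d (L : List (Vec ℕ n)) {F G : Cont n} → (∀ a k → F a k ≡ G a k) → ∀ x k → choose d L F x k ≡ choose d L G x k
choose-cong zero L F≡G x k = F≡G x k
choose-cong (suc d) [] F≡G x k = refl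
choose-cong (suc d) (v ∷ L) F≡G x k = cong₂ _+_ (choose-cong d (v ∷ L) F≡G (x ⊞ v) k) (choose-cong (suc d) L F≡G x k)

choose-one : ∀ {n} {A : Set} (f : A → Vec ℕ n) (xs : List A) F x k →
  choose 1 (map f xs) F x k ≡ sum (map (λ j → F (x ⊞ f j) k) xs)
choose-one f [] F x k = refl
choose-one f (j ∷ xs) F x k = cong (F (x ⊞ f j) k +_) (choose-one f xs F x k)

choose-1∷ : ∀ {n} d (L : List (Vec ℕ n)) F c x k →
  choose d (map (1 ∷_) L) F (c ∷ x) k ≡ choose d L (λ y → F ((d + c) ∷ y)) x k
choose-1∷ zero L F c x k = refl
choose-1∷ (suc d) [] F c x k = refl
choose-1∷ (suc d) (v ∷ L) F c x k =
  cong₂ _+_ (trans (choose-1∷ d (v ∷ L) F (c + 1) (x ⊞ v) k)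
                   (choose-cong d (v ∷ L) (λ y k′ → cong (λ c′ → F (c′ ∷ y) k′) d+[c+1]≡1+d+c) (x ⊞ v) k))
            (choose-1∷ (suc d) L F c x k)
  where
    d+[c+1]≡1+d+c : d + (c + 1) ≡ suc d + c
    d+[c+1]≡1+d+c = trans (cong (d +_) (+-comm c 1)) (+-suc d c)

target : ∀ n → ℕ → Vec ℕ n
target n a = tabulate (λ p → if toℕ p <ᵇ a then 1 else 2)

target-split : ∀ n j → target n 0 ≡ segment n j ⊞ target n j
target-split zero j = refl
target-split (suc n) zero = cong (2 ∷_) (target-split n 0)
target-split (suc n) (suc j) = cong (2 ∷_) (target-split n j)

W : ℕ → ℕ → ℕPoly
W n a = ways n (target n a) (zeros n)

E : ℕ → ℕPoly
E n = Σₚ (upTo (suc n)) (W n)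

U : ℕ → ℕPoly
U n = Σₚ (upTo n) (λ j → W n (suc j))

S : ℕ → ℕPoly
S zero = E 0
S (suc n) = S n +ₚ E (suc n)

E-split : ∀ n → E n ≗ W n 0 +ₚ U n
E-split n k = sum-upTo-suc (λ j → W n j k) n

ways-from-segment : ∀ n j → ways n (target n 0) (zeros n ⊞ segment n j) ≗ W n j
ways-from-segment n j k = begin
    ways n (target n 0) (zeros n ⊞ segment n j) k
  ≡⟨ cong₂ (λ t a → ways n t a k) (target-split n j) (trans (⊞-identityˡ _) (sym (⊞-identityʳ _))) ⟩
    ways n (segment n j ⊞ target n j) (segment n j ⊞ zeros n) k
  ≡⟨ ways-translate n (segment n j) (target n j) (zeros n) k ⟩
    W n j k ∎
  where open ≡-Reasoning

segment-then-rest : ∀ n → choose 1 (segments n) (ways n (target n 0)) (zeros n) ≗ E n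
segment-then-rest n k =
  trans (choose-one (segment n) (upTo (suc n)) (ways n (target n 0)) (zeros n) k)
        (sum-cong (λ j → ways-from-segment n j k) (upTo (suc n)))

W-one : ∀ n a → W (suc n) (suc a) ≗ q· choose 1 (segments n) (ways n (target n a)) (zeros n)
W-one n a = ways-first n 1 0 (target n a) (zeros n)

W-highest : ∀ n → W (suc n) 1 ≗ q· E n
W-highest n k = trans (W-one n 0 k) (q·-cong (segment-then-rest n) k)

-- Targets 1 ∷ 1 ∷ …: the root through α_1 is either α_1 itself, leaving a
-- partition counted by W (suc n) (suc a) with one part fewer, or α_1 + α_2 + …,
-- whose tail plays the part of the root through α_2 in such a partition with
-- the same number of parts.
W-double : ∀ n a → W (suc (suc n)) (suc (suc a)) ≗ [1+q]· W (suc n) (suc a)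
W-double n a k = begin
    W (suc (suc n)) (suc (suc a)) k
  ≡⟨ trans (W-one (suc n) (suc a) k) (q·-cong split k) ⟩
    (q· (W (suc n) (suc a) +ₚ rest)) k
  ≡⟨ q·-+ (W (suc n) (suc a)) rest k ⟩
    (q· W (suc n) (suc a)) k + (q· rest) k
  ≡⟨ cong ((q· W (suc n) (suc a)) k +_) (sym (W-one n a k)) ⟩
    (q· W (suc n) (suc a)) k + W (suc n) (suc a) k
  ≡⟨ +-comm _ (W (suc n) (suc a) k) ⟩
    ([1+q]· W (suc n) (suc a)) k ∎
  where
    open ≡-Reasoning
    G : Cont (suc n)
    G = ways (suc n) (target (suc n) (suc a))
    rest : ℕPoly
    rest = choose 1 (segments n) (ways n (target n a)) (zeros n)
    -- the chosen segment is either empty or of the form 1 ∷ s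
    split : choose 1 (segments (suc n)) G (zeros (suc n)) ≗ W (suc n) (suc a) +ₚ rest
    split k′ =
      trans (cong (λ L → choose 1 L G (zeros (suc n)) k′) (trans (segments-split (suc n)) (cong (zeros (suc n) ∷_) (segments-tail n))))
            (cong₂ _+_ (cong (λ a′ → G a′ k′) (⊞-identityˡ (zeros (suc n))))
                       (trans (choose-1∷ 1 (segments n) G 0 (zeros n) k′)
                              (choose-cong 1 (segments n) (ways-head n 1 (target n a)) (zeros n) k′)))

pairs : ℕ → ℕPoly
pairs n = choose 2 (segments n) (ways n (target n 0)) (zeros n)

W-zero-pairs : ∀ n → W (suc n) 0 ≗ q^ 2 · pairs n
W-zero-pairs n = ways-first n 2 0 (target n 0) (zeros n)

-- Either the empty segment is among the two, or both are of the form 1 ∷ s.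
pairs-step : ∀ n → pairs n ≗ E n +ₚ choose 2 (map (λ j → segment n (suc j)) (upTo n)) (ways n (target n 0)) (zeros n)
pairs-step n k =
  trans (cong (λ L → choose 2 L G (zeros n) k) (segments-split n))
        (cong (_+ choose 2 (map (λ j → segment n (suc j)) (upTo n)) G (zeros n) k)
              (trans (cong₂ (λ L a → choose 1 L G a k) (sym (segments-split n)) (⊞-identityˡ (zeros n)))
                     (segment-then-rest n k)))
  where
    G : Cont n
    G = ways n (target n 0)

-- Unfolding pairs-step down to B_0 accumulates E n, E (n-1), …, E 0.
pairs-cumulative : ∀ n → pairs n ≗ S n
pairs-cumulative zero k = trans (pairs-step 0 k) (+-identityʳ _)
pairs-cumulative (suc n) k = begin
    pairs (suc n) k
  ≡⟨ pairs-step (suc n) k ⟩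
    E (suc n) k + choose 2 (map (λ j → segment (suc n) (suc j)) (upTo (suc n))) G (zeros (suc n)) k
  ≡⟨ cong (λ L → E (suc n) k + choose 2 L G (zeros (suc n)) k) (segments-tail n) ⟩
    E (suc n) k + choose 2 (map (1 ∷_) (segments n)) G (zeros (suc n)) k
  ≡⟨ cong (E (suc n) k +_) (trans (choose-1∷ 2 (segments n) G 0 (zeros n) k)
                                  (choose-cong 2 (segments n) (ways-head n 2 (target n 0)) (zeros n) k)) ⟩
    E (suc n) k + pairs n k
  ≡⟨ +-comm (E (suc n) k) _ ⟩
    pairs n k + E (suc n) k
  ≡⟨ cong (_+ E (suc n) k) (pairs-cumulative n k) ⟩
    S (suc n) k ∎
  where
    open ≡-Reasoning
    G : Cont (suc n)
    G = ways (suc n) (target (suc n) 0)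

W-zero : ∀ n → W (suc n) 0 ≗ q^ 2 · S n
W-zero n k = trans (W-zero-pairs n k) (q^-cong 2 (pairs-cumulative n) k)

U-rec : ∀ m → U (suc m) ≗ q· E m +ₚ [1+q]· U m
U-rec zero k = trans (+-identityʳ _) (trans (W-highest 0 k) (sym (trans (cong ((q· E 0) k +_) (q^-0 1 k)) (+-identityʳ _))))
U-rec (suc m) k =
  trans (sum-upTo-suc (λ j → W (suc (suc m)) (suc j) k) (suc m))
        (cong₂ _+_ (W-highest (suc m) k)
                   (trans (Σₚ-cong (upTo (suc m)) (λ j → W-double m j) k)
                          (sym ([1+q]·-Σ (upTo (suc m)) (λ j → W (suc m) (suc j)) k))))

E-lower : ∀ m → E (suc m) ≗ q^ 2 · S m +ₚ U (suc m)
E-lower m k = trans (E-split (suc m) k) (cong (_+ U (suc m) k) (W-zero m k))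

E-recurrence : ∀ m → E (suc (suc m)) +ₚ q^ 3 · S m ≗ [1+q]· [1+q]· E (suc m)
E-recurrence m k = begin
    E (suc (suc m)) k + f
  ≡⟨ cong (_+ f) (trans (E-split (suc (suc m)) k)
                        (cong₂ _+_ (trans (W-zero (suc m) k) (q^-+ 2 (S m) (E (suc m)) k)) (U-rec (suc m) k))) ⟩
    (a + b) + (c + (d + e)) + f
  ≡⟨ rearrange a b c d e f ⟩
    ((a + d) + c) + ((f + e) + b)
  ≡⟨ sym (cong₂ _+_ (cong (_+ c) (E-lower m k))
                    (cong (_+ b) (trans (q·-cong (E-lower m) k) (q·-+ (q^ 2 · S m) (U (suc m)) k)))) ⟩
    (E (suc m) k + c) + (c + b)
  ≡⟨ cong (E (suc m) k + c +_) (sym (q·-+ (E (suc m)) (q· E (suc m)) k)) ⟩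
    ([1+q]· [1+q]· E (suc m)) k ∎
  where
    open ≡-Reasoning
    a = (q^ 2 · S m) k
    b = (q^ 2 · E (suc m)) k
    c = (q· E (suc m)) k
    d = U (suc m) k
    e = (q· U (suc m)) k
    f = (q^ 3 · S m) k
    rearrange : ∀ a b c d e f → (a + b) + (c + (d + e)) + f ≡ ((a + d) + c) + ((f + e) + b)
    rearrange = solve 6 (λ a b c d e f → (a :+ b) :+ (c :+ (d :+ e)) :+ f := ((a :+ d) :+ c) :+ ((f :+ e) :+ b)) refl
      where open +-*-Solver

q·-[1+q] : ∀ f → q· [1+q]· f ≗ [1+q]· q· f
q·-[1+q] f zero = refl
q·-[1+q] f (suc k) = refl

highest-target : ∀ n → highest n ≡ target n 1
highest-target n = tabulate-cong (λ p → first (toℕ p))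
  where
    first : ∀ i → (if i ≡ᵇ 0 then 1 else 2) ≡ (if i <ᵇ 1 then 1 else 2)
    first zero = refl
    first (suc i) = refl

dNH-suc : ∀ n → dNH (suc n) ≗ q· E n
dNH-suc n k =
  trans (countMS-as-count (nonhookedRoots (suc n)) (highest (suc n)) (zeros (suc n)) k)
        (trans (cong (λ t → ways (suc n) t (zeros (suc n)) k) (highest-target (suc n))) (W-highest n k))

sumₙ : (ℕ → ℕPoly) → ℕ → ℕPoly
sumₙ F zero = 0ₚ
sumₙ F (suc m) = sumₙ F m +ₚ F (suc m)

sum-dNH : ∀ m → sumₙ dNH (suc m) ≗ q· S m
sum-dNH zero k = dNH-suc 0 k
sum-dNH (suc m) k = trans (cong₂ _+_ (sum-dNH m k) (dNH-suc (suc m) k)) (sym (q·-+ (S m) (E (suc m)) k))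

recurrence-ℕ : ∀ m → dNH (3 + m) +ₚ q^ 3 · sumₙ dNH (suc m) ≗ [1+q]· [1+q]· dNH (2 + m)
recurrence-ℕ m k = begin
    dNH (3 + m) k + (q^ 3 · sumₙ dNH (suc m)) k
  ≡⟨ cong₂ _+_ (dNH-suc (2 + m) k) (q^-cong 3 (sum-dNH m) k) ⟩
    (q· E (2 + m)) k + (q· q^ 3 · S m) k
  ≡⟨ sym (q·-+ (E (2 + m)) (q^ 3 · S m) k) ⟩
    (q· (E (2 + m) +ₚ q^ 3 · S m)) k
  ≡⟨ q·-cong (E-recurrence m) k ⟩
    (q· [1+q]· [1+q]· E (1 + m)) k
  ≡⟨ trans (q·-[1+q] ([1+q]· E (1 + m)) k) ([1+q]·-cong (q·-[1+q] (E (1 + m))) k) ⟩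
    ([1+q]· [1+q]· q· E (1 + m)) k
  ≡⟨ [1+q]·-cong ([1+q]·-cong (λ k′ → sym (dNH-suc (1 + m) k′))) k ⟩
    ([1+q]· [1+q]· dNH (2 + m)) k ∎
  where open ≡-Reasoning

qmul-pos : ∀ {F : Poly} {f : ℕPoly} → (∀ k → F k ≡ pos (f k)) → ∀ k → qmul F k ≡ pos ((q· f) k)
qmul-pos F≡f zero = refl
qmul-pos F≡f (suc k) = F≡f k

onePlusQ-pos : ∀ {F : Poly} {f : ℕPoly} → (∀ k → F k ≡ pos (f k)) → ∀ k → onePlusQ F k ≡ pos (([1+q]· f) k)
onePlusQ-pos {F} {f} F≡f k = trans (cong₂ _+ℤ_ (F≡f k) (qmul-pos F≡f k)) (sym (pos-+ (f k) ((q· f) k)))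

sumP-pos : ∀ m k → sumP PNH m k ≡ pos (sumₙ dNH m k)
sumP-pos zero k = refl
sumP-pos (suc m) k = trans (cong (_+ℤ PNH (suc m) k) (sumP-pos m k)) (sym (pos-+ (sumₙ dNH m k) (dNH (suc m) k)))

pos-difference : ∀ a b c → a + c ≡ b → pos a ≡ pos b -ℤ pos c
pos-difference a b c refl =
  sym (trans ([+m]-[+n]≡m⊖n (a + c) c) (trans (⊖-≥ (m≤n+m c a)) (cong pos (m+n∸n≡m a c))))

proposition3p5 : ∀ (r : ℕ) → 3 ≤ r → ∀ (k : ℕ) →
    PNH r k ≡ (onePlusQ (onePlusQ (PNH (r ∸ 1))) ⊖ qmul (qmul (qmul (sumP PNH (r ∸ 2))))) k
proposition3p5 (suc zero) (s≤s ()) k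
proposition3p5 (suc (suc zero)) (s≤s (s≤s ())) k
proposition3p5 (suc (suc (suc m))) _ k =
  trans (pos-difference _ _ _ (recurrence-ℕ m k))
        (sym (cong₂ _-ℤ_ (onePlusQ-pos (onePlusQ-pos (λ _ → refl)) k)
                         (qmul-pos (qmul-pos (qmul-pos (sumP-pos (suc m)))) k)))
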